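{- Let $0\leq i\leq j-1$ be integers and $G$ an $(i,j)$-critical multigraph. If $v$ is a vertex of $G$ such that at most one edge of $G$ joins $v$ to a vertex of degree at least $3$, then $v$ has at least $i+2$ distinct neighbors.
   Context: Multigraphs are finite without loops; the degree of a vertex counts incident edges with multiplicity. A 2-fold cover of a multigraph $G$ is a pair $(L,\mathcal H)$ where $\mathcal H$ is a graph and $L$ assigns to each $v\in V(G)$ a 2-element set $L(v)=\{p(v),r(v)\}$ ($p(v)$ poor, $r(v)$ rich) such that the sets $L(v)$ partition $V(\mathcal H)$, $p(v)r(v)\in E(\mathcal H)$, edges of $\mathcal H$ between $L(u)$ and $L(v)$ ($u\ne v$) exist only if $uv\in E(G)$, and if $u,v$ are joined by $k\ge1$ edges then $\mathcal H[L(u),L(v)]$ is a union of at most $k$ perfect matchings between $L(u)$ and $L(v)$. An $\mathcal H$-map is a function $\phi$ with $\phi(v)\in L(v)$; $\mathcal H_\phi$ is the subgraph induced by $\phi(V(G))$. An $(i,j)$-coloring is an $\mathcal H$-map $\phi$ in which poor vertices of $\mathcal H_\phi$ have degree at most $i$ and rich ones degree at most $j$ in $\mathcal H_\phi$. $G$ is $(i,j)$-critical if some 2-fold cover of $G$ has no $(i,j)$-coloring while every 2-fold cover of each proper subgraph has one. -}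

module Defs where

open import Data.Nat using (ℕ; zero; suc; _+_; _≤_; _<_)
open import Data.Bool using (Bool; true; false; if_then_else_; _xor_)
open import Data.Fin using (Fin)
open import Data.List using (List; map; length)
open import Data.Nat.ListAction using (sum)
open import Data.Bool.ListAction using (any)
open import Data.List.Base using (allFin)
open import Data.Product using (Σ; _×_; _,_; ∃; ∃-syntax)
open import Data.Sum using (_⊎_)
open import Relation.Binary.PropositionalEquality using (_≡_; _≢_)
open import Relation.Nullary using (¬_)
open import Function.Definitions using (Injective)

record Multigraph : Set where
  field
    n     : ℕ
    mult  : Fin n → Fin n → ℕ
    msym  : ∀ u v → mult u v ≡ mult v u
    loopless : ∀ v → mult v v ≡ 0
open Multigraph public

Σfin : ∀ {k} → (Fin k → ℕ) → ℕ
Σfin {k} f = sum (map f (allFin k))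

deg : (G : Multigraph) → Fin (n G) → ℕ
deg G v = Σfin (λ u → mult G v u)

nbrs : (G : Multigraph) → Fin (n G) → ℕ
nbrs G v = Σfin (λ u → if isPos (mult G v u) then 1 else 0)
  where
  isPos : ℕ → Bool
  isPos zero    = false
  isPos (suc _) = true

edgesToDeg≥3 : (G : Multigraph) → Fin (n G) → ℕ
edgesToDeg≥3 G v = Σfin (λ u → if atLeast3 (deg G u) then mult G v u else 0)
  where
  atLeast3 : ℕ → Bool
  atLeast3 (suc (suc (suc _))) = true
  atLeast3 _                   = false

record Subgraph (H G : Multigraph) : Set where
  field
    f     : Fin (n H) → Fin (n G)
    inj   : Injective _≡_ _≡_ f
    multLe : ∀ u v → mult H u v ≤ mult G (f u) (f v)
open Subgraph public

Proper : ∀ {H G} → Subgraph H G → Set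
Proper {H} {G} s =
  (∃[ w ] (∀ u → f s u ≢ w)) ⊎ (∃[ u ] ∃[ v ] (mult H u v < mult G (f s u) (f s v)))

-- WLOG V(ℋ) = V(G) × Bool with L(v) = {(v,false),(v,true)},
-- p(v) = (v,false) poor, r(v) = (v,true) rich.  ℋ is a simple graph given by
-- a Bool-valued symmetric irreflexive adjacency.
-- A perfect matching between L(u) and L(v) is a bijection Bool → Bool,
-- i.e. determined by a "twist" bit t: (u,a) matched with (v,b) iff a xor b ≡ t.
inMatching : Bool → Bool → Bool → Bool
inMatching t a b = if t then (a xor b) else (if a xor b then false else true)

record Cover (G : Multigraph) : Set where
  field
    adj      : Fin (n G) × Bool → Fin (n G) × Bool → Bool
    adjSym   : ∀ x y → adj x y ≡ adj y x
    irrefl   : ∀ x → adj x x ≡ false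
    poorRich : ∀ v → adj (v , false) (v , true) ≡ true
    -- for u ≠ v, ℋ[L(u),L(v)] is a union of at most mult u v perfect matchings
    -- (in particular empty when u,v are non-adjacent)
    matchings : ∀ u v → u ≢ v →
      Σ (List Bool) λ ms → (length ms ≤ mult G u v) ×
        (∀ a b → adj (u , a) (v , b) ≡ any (λ t → inMatching t a b) ms)
open Cover public

-- H-maps: choose φ(v) ∈ L(v), i.e. a Bool per vertex (false = poor)
HMap : Multigraph → Set
HMap G = Fin (n G) → Bool

degφ : ∀ {G} → Cover G → HMap G → Fin (n G) → ℕ
degφ {G} C φ v = Σfin (λ u → if adj C (v , φ v) (u , φ u) then 1 else 0)

IsColoring : ∀ {G} → ℕ → ℕ → Cover G → HMap G → Set
IsColoring {G} i j C φ =
  ∀ v → degφ C φ v ≤ (if φ v then j else i)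

Colorable : ∀ {G} → ℕ → ℕ → Cover G → Set
Colorable i j C = ∃[ φ ] IsColoring i j C φ

Critical : ℕ → ℕ → Multigraph → Set
Critical i j G =
  (∃[ C ] ¬ Colorable {G} i j C) ×
  (∀ (H : Multigraph) (s : Subgraph H G) → Proper s →
     ∀ (C : Cover H) → Colorable i j C)

-- Suppose v had at most i + 1 neighbours. By criticality the cover restricted to G − v has an
-- (i,j)-colouring ψ. At most one neighbour w of v has degree ≥ 3, and it is joined to v by a
-- single edge; colour v by the vertex of L(v) not adjacent to ψ(w), which leaves v at most i
-- coloured neighbours (if v has no simple edge at all, colour it rich: i + 1 ≤ j). Every other
-- neighbour y has degree ≤ 2: if it is joined to v by a double edge, make it rich; if it is now
-- adjacent to the colour of v along a single edge and has a further coloured neighbour, switch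
-- it to its other vertex, which that single edge keeps away from v. As these vertices have
-- degree ≤ 2, the changes create no conflicts elsewhere, contradicting criticality.

module Submission where

open import Defs
open import Data.Nat using (ℕ; zero; suc; _+_; _≤_; _<_; z≤n; s≤s; _≤?_; _≟_)
open import Data.Nat.Properties
open import Data.Fin using (Fin; zero; suc; punchIn)
open import Data.Fin.Properties
  using (any?; punchInᵢ≢i; punchIn-injective; punchIn-punchOut) renaming (_≟_ to _≟ᶠ_)
open import Data.Bool using (Bool; true; false; if_then_else_; not; _∨_)
open import Data.Bool.ListAction using (any)
open import Data.Bool.Properties using (∨-identityʳ) renaming (_≟_ to _≟ᵇ_)
open import Data.List using ([]; _∷_; length)
import Data.Nat.ListAction
open import Data.List.Properties using (map-tabulate)
open import Data.Product as Product using (_×_; _,_; ∃-syntax; proj₁; proj₂)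
open import Data.Sum using (inj₁)
open import Data.Vec.Functional using (insertAt)
open import Data.Vec.Functional.Properties using (insertAt-punchIn)
open import Relation.Binary.PropositionalEquality
open import Relation.Nullary using (¬_; Dec; yes; no; does)
open import Relation.Nullary.Decidable using (_×-dec_)
open import Relation.Nullary.Negation using (contradiction)
open import Function using (_∘_; id)
open import Algebra.Properties.CommutativeMonoid.Sum +-0-commutativeMonoid
  using (sum; sum-remove; sum-cong-≗)

indicator : Bool → ℕ
indicator b = if b then 1 else 0

indicator≤1 : ∀ b → indicator b ≤ 1
indicator≤1 true  = s≤s z≤n
indicator≤1 false = z≤n

indicator-false≤ : ∀ {b} k → b ≡ false → indicator b ≤ k
indicator-false≤ k refl = z≤n

indicator-positive : ∀ {b} → 1 ≤ indicator b → b ≡ true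
indicator-positive {true} _ = refl

bound : ℕ → ℕ → Bool → ℕ
bound i j b = if b then j else i

i≤bound : ∀ {i j} → i < j → ∀ b → i ≤ bound i j b
i≤bound i<j true  = <⇒≤ i<j
i≤bound i<j false = ≤-refl

-- Opaque so that f is inferred from goals of the form erase a f u ≤ m.
opaque
  erase : ∀ {k} → Fin k → (Fin k → ℕ) → Fin k → ℕ
  erase a f u = if does (u ≟ᶠ a) then 0 else f u

  erase-self : ∀ {k} (a : Fin k) f → erase a f a ≡ 0
  erase-self a f with a ≟ᶠ a
  ... | yes _ = refl
  ... | no a≢a = contradiction refl a≢a

  erase-other : ∀ {k} {a u : Fin k} f → u ≢ a → erase a f u ≡ f u
  erase-other {a = a} {u} f u≢a with u ≟ᶠ a
  ... | yes u≡a = contradiction u≡a u≢a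
  ... | no _ = refl

  erase-≤ : ∀ {k} (a : Fin k) {f : Fin k → ℕ} u {m} → (u ≢ a → f u ≤ m) → erase a f u ≤ m
  erase-≤ a u f≤m with u ≟ᶠ a
  ... | yes _ = z≤n
  ... | no u≢a = f≤m u≢a

  erase-mono-≤ : ∀ {k} (a : Fin k) {f g : Fin k → ℕ} u → (u ≢ a → f u ≤ g u) →
                 erase a f u ≤ erase a g u
  erase-mono-≤ a u f≤g with u ≟ᶠ a
  ... | yes _ = z≤n
  ... | no u≢a = f≤g u≢a

  erase-positive : ∀ {k} (a : Fin k) f {u} → 1 ≤ erase a f u → u ≢ a × 1 ≤ f u
  erase-positive a f {u} pos with u ≟ᶠ a
  ... | no u≢a = u≢a , pos

Σfin-suc : ∀ {k} (f : Fin (suc k) → ℕ) → Σfin f ≡ f zero + Σfin (f ∘ suc)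
Σfin-suc f = cong (λ xs → f zero + Data.Nat.ListAction.sum xs)
  (trans (map-tabulate suc f) (sym (map-tabulate id (f ∘ suc))))

Σfin≡sum : ∀ {k} (f : Fin k → ℕ) → Σfin f ≡ sum f
Σfin≡sum {zero}  f = refl
Σfin≡sum {suc k} f = trans (Σfin-suc f) (cong (f zero +_) (Σfin≡sum (f ∘ suc)))

Σfin-cong : ∀ {k} {f g : Fin k → ℕ} → (∀ u → f u ≡ g u) → Σfin f ≡ Σfin g
Σfin-cong {f = f} {g} f≗g = trans (Σfin≡sum f) (trans (sum-cong-≗ f≗g) (sym (Σfin≡sum g)))

Σfin-mono-≤ : ∀ {k} {f g : Fin k → ℕ} → (∀ u → f u ≤ g u) → Σfin f ≤ Σfin g
Σfin-mono-≤ {zero}  f≤g = z≤n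
Σfin-mono-≤ {suc k} {f} {g} f≤g = begin
  Σfin f                   ≡⟨ Σfin-suc f ⟩
  f zero + Σfin (f ∘ suc)  ≤⟨ +-mono-≤ (f≤g zero) (Σfin-mono-≤ (f≤g ∘ suc)) ⟩
  g zero + Σfin (g ∘ suc)  ≡⟨ Σfin-suc g ⟨
  Σfin g                   ∎
  where open ≤-Reasoning

Σfin-punchIn : ∀ {m} (a : Fin (suc m)) (f : Fin (suc m) → ℕ) → Σfin f ≡ f a + Σfin (f ∘ punchIn a)
Σfin-punchIn a f = begin
  Σfin f                        ≡⟨ Σfin≡sum f ⟩
  sum f                         ≡⟨ sum-remove f ⟩
  f a + sum (f ∘ punchIn a)     ≡⟨ cong (f a +_) (Σfin≡sum (f ∘ punchIn a)) ⟨
  f a + Σfin (f ∘ punchIn a)    ∎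
  where open ≡-Reasoning

Σfin-erase-punchIn : ∀ {m} (a : Fin (suc m)) f → Σfin (erase a f) ≡ Σfin (f ∘ punchIn a)
Σfin-erase-punchIn a f = begin
  Σfin (erase a f)                            ≡⟨ Σfin-punchIn a (erase a f) ⟩
  erase a f a + Σfin (erase a f ∘ punchIn a)  ≡⟨ cong₂ _+_ (erase-self a f) (Σfin-cong erase-punchIn) ⟩
  Σfin (f ∘ punchIn a)                        ∎
  where
  open ≡-Reasoning
  erase-punchIn : ∀ x → erase a f (punchIn a x) ≡ f (punchIn a x)
  erase-punchIn x = erase-other f (punchInᵢ≢i a x)

Σfin-erase : ∀ {k} (a : Fin k) f → Σfin f ≡ f a + Σfin (erase a f)
Σfin-erase {suc m} a f = trans (Σfin-punchIn a f) (cong (f a +_) (sym (Σfin-erase-punchIn a f)))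

fᵢ≤Σfin : ∀ {k} (a : Fin k) f → f a ≤ Σfin f
fᵢ≤Σfin a f = ≤-trans (m≤m+n (f a) _) (≤-reflexive (sym (Σfin-erase a f)))

fᵢ+fⱼ≤Σfin : ∀ {k} {a b : Fin k} f → a ≢ b → f a + f b ≤ Σfin f
fᵢ+fⱼ≤Σfin {a = a} {b} f a≢b = begin
  f a + f b                 ≡⟨ cong (f a +_) (erase-other f (a≢b ∘ sym)) ⟨
  f a + erase a f b         ≤⟨ +-monoʳ-≤ (f a) (fᵢ≤Σfin b (erase a f)) ⟩
  f a + Σfin (erase a f)    ≡⟨ Σfin-erase a f ⟨
  Σfin f                    ∎
  where open ≤-Reasoning

Σfin-erase-≤ : ∀ {k} (a : Fin k) f {d} → Σfin f ≤ f a + d → Σfin (erase a f) ≤ d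
Σfin-erase-≤ a f ≤f+d = +-cancelˡ-≤ (f a) _ _ (≤-trans (≤-reflexive (sym (Σfin-erase a f))) ≤f+d)

Σfin≤1⇒other≡0 : ∀ {k} (f : Fin k → ℕ) {a b} → Σfin f ≤ 1 → a ≢ b → 1 ≤ f a → f b ≡ 0
Σfin≤1⇒other≡0 f {a} {b} Σ≤1 a≢b pos = n≤0⇒n≡0 (+-cancelˡ-≤ 1 (f b) 0
  (≤-trans (+-monoˡ-≤ (f b) pos) (≤-trans (fᵢ+fⱼ≤Σfin f a≢b) Σ≤1)))

Σfin-positive : ∀ {k} (f : Fin k → ℕ) → 1 ≤ Σfin f → ∃[ u ] 1 ≤ f u
Σfin-positive {suc k} f pos with 1 ≤? f zero
... | yes head-pos = zero , head-pos
... | no head-zero = Product.map suc id (Σfin-positive (f ∘ suc) (begin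
  1                        ≤⟨ pos ⟩
  Σfin f                   ≡⟨ Σfin-suc f ⟩
  f zero + Σfin (f ∘ suc)  ≡⟨ cong (_+ Σfin (f ∘ suc)) (n<1⇒n≡0 (≰⇒> head-zero)) ⟩
  Σfin (f ∘ suc)           ∎))
  where open ≤-Reasoning

-- Defs builds the summands of nbrs and edgesToDeg≥3 with helpers local to a
-- where clause; unifying the sum with refl recovers them.
summand : ∀ {k} {f : Fin k → ℕ} (s : ℕ) → s ≡ Σfin f → Fin k → ℕ
summand {f = f} _ _ = f

neighbourTerm : (G : Multigraph) → Fin (n G) → Fin (n G) → ℕ
neighbourTerm G v = summand (nbrs G v) refl

heavyEdgeTerm : (G : Multigraph) → Fin (n G) → Fin (n G) → ℕ
heavyEdgeTerm G v = summand (edgesToDeg≥3 G v) refl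

neighbourTerm-edge : ∀ G {v u} → 1 ≤ mult G v u → neighbourTerm G v u ≡ 1
neighbourTerm-edge G {v} {u} edge with mult G v u
... | suc _ = refl

heavyEdgeTerm-heavy : ∀ G {v u} → 3 ≤ deg G u → heavyEdgeTerm G v u ≡ mult G v u
heavyEdgeTerm-heavy G {v} {u} heavy with deg G u | heavy
... | suc (suc (suc _)) | _ = refl
... | suc zero          | s≤s ()
... | suc (suc zero)    | s≤s (s≤s ())

edge⇒≢ : ∀ G {u w} → 1 ≤ mult G u w → u ≢ w
edge⇒≢ G {u} edge refl = 1+n≰n (≤-trans edge (≤-reflexive (loopless G u)))

mult≤deg : ∀ G u w → mult G u w ≤ deg G u
mult≤deg G u w = fᵢ≤Σfin w (mult G u)

degreeWithout≤ : ∀ G {u w k d} → deg G u ≤ k + d → mult G u w ≡ k →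
                 Σfin (erase w (mult G u)) ≤ d
degreeWithout≤ G {u} {w} deg≤ refl = Σfin-erase-≤ w (mult G u) deg≤

light-double⇒isolated : ∀ G {u w y} → deg G u ≤ 2 → mult G u w ≡ 2 → y ≢ w → mult G u y ≡ 0
light-double⇒isolated G {u} {w} {y} light double y≢w = n≤0⇒n≡0 (begin
  mult G u y                  ≡⟨ erase-other (mult G u) y≢w ⟨
  erase w (mult G u) y        ≤⟨ fᵢ≤Σfin y _ ⟩
  Σfin (erase w (mult G u))   ≤⟨ degreeWithout≤ G light double ⟩
  0                           ∎)
  where open ≤-Reasoning

heavy⇒simple : ∀ G {v u} → edgesToDeg≥3 G v ≤ 1 → 3 ≤ deg G u → mult G v u ≤ 1
heavy⇒simple G {v} {u} sparse heavy = begin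
  mult G v u                  ≡⟨ heavyEdgeTerm-heavy G heavy ⟨
  heavyEdgeTerm G v u         ≤⟨ fᵢ≤Σfin u (heavyEdgeTerm G v) ⟩
  edgesToDeg≥3 G v            ≤⟨ sparse ⟩
  1                           ∎
  where open ≤-Reasoning

heavyNeighbour-unique : ∀ G {v u w} → edgesToDeg≥3 G v ≤ 1 → 3 ≤ deg G u → 3 ≤ deg G w →
                        1 ≤ mult G v u → 1 ≤ mult G v w → u ≡ w
heavyNeighbour-unique G {v} {u} {w} sparse heavyᵤ heavyʷ edgeᵤ edgeʷ with u ≟ᶠ w
... | yes u≡w = u≡w
... | no u≢w = contradiction (begin
  2                                          ≤⟨ +-mono-≤ edgeᵤ edgeʷ ⟩
  mult G v u + mult G v w                    ≡⟨ cong₂ _+_ (heavyEdgeTerm-heavy G heavyᵤ)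
                                                          (heavyEdgeTerm-heavy G heavyʷ) ⟨
  heavyEdgeTerm G v u + heavyEdgeTerm G v w  ≤⟨ fᵢ+fⱼ≤Σfin (heavyEdgeTerm G v) u≢w ⟩
  edgesToDeg≥3 G v                           ≤⟨ sparse ⟩
  1                                          ∎) λ { (s≤s ()) }
  where open ≤-Reasoning

data Shape (G : Multigraph) (v : Fin (n G)) : Set where
  noSimpleEdge : (∀ u → mult G v u ≢ 1) → (∀ u → 1 ≤ mult G v u → deg G u ≤ 2) → Shape G v
  simpleEdgeTo : ∀ w → mult G v w ≡ 1 → (∀ u → u ≢ w → 1 ≤ mult G v u → deg G u ≤ 2) →
                 Shape G v

shape : ∀ G v → edgesToDeg≥3 G v ≤ 1 → Shape G v
shape G v sparse with any? (λ u → (3 ≤? deg G u) ×-dec (1 ≤? mult G v u))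
... | yes (w , heavy , edge) =
  simpleEdgeTo w (≤-antisym (heavy⇒simple G sparse heavy) edge) λ u u≢w edgeᵤ →
    ≤-pred (≰⇒> λ heavyᵤ → u≢w (heavyNeighbour-unique G sparse heavyᵤ heavy edgeᵤ edge))
... | no noHeavy = shapeWithoutHeavy (any? (λ u → mult G v u ≟ 1))
  where
  allLight : ∀ u → 1 ≤ mult G v u → deg G u ≤ 2
  allLight u edge = ≤-pred (≰⇒> λ heavy → noHeavy (u , heavy , edge))

  shapeWithoutHeavy : Dec (∃[ w ] mult G v w ≡ 1) → Shape G v
  shapeWithoutHeavy (yes (w , simple)) = simpleEdgeTo w simple (λ u _ → allLight u)
  shapeWithoutHeavy (no noSimple) = noSimpleEdge (λ u simple → noSimple (u , simple)) allLight

inMatching-flip : ∀ t a b → inMatching t a (not b) ≡ not (inMatching t a b)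
inMatching-flip true  true  b     = refl
inMatching-flip true  false b     = refl
inMatching-flip false true  true  = refl
inMatching-flip false true  false = refl
inMatching-flip false false true  = refl
inMatching-flip false false false = refl

links : ∀ {G} → Cover G → Fin (n G) × Bool → HMap G → Fin (n G) → ℕ
links C x φ u = indicator (adj C x (u , φ u))

module _ {G : Multigraph} (C : Cover G) where

  adj⇒edge : ∀ {u w a b} → u ≢ w → adj C (u , a) (w , b) ≡ true → 1 ≤ mult G u w
  adj⇒edge {u} {w} {a} {b} u≢w adjacent with matchings C u w u≢w
  ... | ms , len , covered = ≤-trans (nonempty ms (trans (sym (covered a b)) adjacent)) len
    where
    nonempty : ∀ ms → any (λ t → inMatching t a b) ms ≡ true → 1 ≤ length ms
    nonempty (_ ∷ _) _ = s≤s z≤n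

  noEdge⇒¬adj : ∀ {u w a b} → u ≢ w → mult G u w ≡ 0 → adj C (u , a) (w , b) ≡ false
  noEdge⇒¬adj {u} {w} {a} {b} u≢w noEdge with adj C (u , a) (w , b) in adjacent
  ... | false = refl
  ... | true = contradiction (≤-trans (adj⇒edge u≢w adjacent) (≤-reflexive noEdge)) λ ()

  adj⇒≢ : ∀ {u w} (φ : HMap G) → adj C (u , φ u) (w , φ w) ≡ true → u ≢ w
  adj⇒≢ {u} φ adjacent refl = contradiction (trans (sym adjacent) (irrefl C (u , φ u))) λ ()

  indicator-adj≤mult : ∀ {u w a b} → u ≢ w → indicator (adj C (u , a) (w , b)) ≤ mult G u w
  indicator-adj≤mult {u} {w} {a} {b} u≢w with adj C (u , a) (w , b) in adjacent
  ... | false = z≤n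
  ... | true = adj⇒edge u≢w adjacent

  indicator-adj≤neighbourTerm : ∀ {u w a b} → u ≢ w →
                                indicator (adj C (u , a) (w , b)) ≤ neighbourTerm G u w
  indicator-adj≤neighbourTerm {u} {w} {a} {b} u≢w
    with mult G u w | indicator-adj≤mult {a = a} {b} u≢w
  ... | zero  | ≤0 = ≤0
  ... | suc _ | _  = indicator≤1 _

  simpleEdge-unique : ∀ {u w a b} → u ≢ w → mult G u w ≡ 1 →
                      adj C (u , a) (w , b) ≡ true → adj C (u , a) (w , not b) ≡ false
  simpleEdge-unique {u} {w} {a} {b} u≢w simple adjacent with matchings C u w u≢w
  ... | ms , len , covered =
    trans (covered a (not b))
          (single ms (≤-trans len (≤-reflexive simple)) (trans (sym (covered a b)) adjacent))
    where
    open ≡-Reasoning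
    single : ∀ ms → length ms ≤ 1 → any (λ t → inMatching t a b) ms ≡ true →
             any (λ t → inMatching t a (not b)) ms ≡ false
    single (t ∷ []) _ matched = begin
      inMatching t a (not b) ∨ false  ≡⟨ ∨-identityʳ _ ⟩
      inMatching t a (not b)          ≡⟨ inMatching-flip t a b ⟩
      not (inMatching t a b)          ≡⟨ cong not (trans (sym (∨-identityʳ _)) matched) ⟩
      false                           ∎
    single (_ ∷ _ ∷ _) (s≤s ()) _

  simpleEdge-uniqueˡ : ∀ {u w a b} → u ≢ w → mult G u w ≡ 1 →
                       adj C (u , a) (w , b) ≡ true → adj C (u , not a) (w , b) ≡ false
  simpleEdge-uniqueˡ {u} {w} u≢w simple adjacent = trans (adjSym C _ _)
    (simpleEdge-unique (u≢w ∘ sym) (trans (msym G w u) simple) (trans (adjSym C _ _) adjacent))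

  degφ-erase : ∀ φ y → degφ C φ y ≡ Σfin (erase y (links C (y , φ y) φ))
  degφ-erase φ y = trans (Σfin-erase y (links C (y , φ y) φ))
    (cong (λ b → indicator b + Σfin (erase y (links C (y , φ y) φ))) (irrefl C (y , φ y)))

deleteVertex : (G : Multigraph) → Fin (n G) → Multigraph
deleteVertex record { n = suc m ; mult = μ ; msym = μ-sym ; loopless = μ-loopless } v = record
  { n        = m
  ; mult     = λ x y → μ (punchIn v x) (punchIn v y)
  ; msym     = λ x y → μ-sym (punchIn v x) (punchIn v y)
  ; loopless = λ x → μ-loopless (punchIn v x)
  }

deleteVertex-subgraph : ∀ G v → Subgraph (deleteVertex G v) G
deleteVertex-subgraph record { n = suc m } v = record
  { f = punchIn v ; inj = punchIn-injective v _ _ ; multLe = λ _ _ → ≤-refl }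

deleteVertex-proper : ∀ G v → Proper (deleteVertex-subgraph G v)
deleteVertex-proper record { n = suc m } v = inj₁ (v , punchInᵢ≢i v)

restrictCover : ∀ {G} → Cover G → ∀ v → Cover (deleteVertex G v)
restrictCover {record { n = suc m }} C v = record
  { adj       = λ (x , a) (y , b) → adj C (punchIn v x , a) (punchIn v y , b)
  ; adjSym    = λ _ _ → adjSym C _ _
  ; irrefl    = λ _ → irrefl C _
  ; poorRich  = λ _ → poorRich C _
  ; matchings = λ x y x≢y → matchings C (punchIn v x) (punchIn v y) (x≢y ∘ punchIn-injective v x y)
  }

degreeAway : ∀ {G} → Cover G → HMap G → Fin (n G) → Fin (n G) → ℕ
degreeAway C ψ v y = Σfin (erase v (links C (y , ψ y) ψ))

ColouringAway : ℕ → ℕ → ∀ {G} → Cover G → Fin (n G) → HMap G → Set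
ColouringAway i j {G} C v ψ = ∀ y → y ≢ v → degreeAway C ψ v y ≤ bound i j (ψ y)

colouringAway : ∀ {i j} G → Critical i j G → (C : Cover G) (v : Fin (n G)) →
                ∃[ ψ ] ColouringAway i j C v ψ
colouringAway {i} {j} G@record { n = suc m } (_ , minimal) C v = ψ′ , away
  where
  colouring : Colorable i j (restrictCover C v)
  colouring = minimal (deleteVertex G v) (deleteVertex-subgraph G v) (deleteVertex-proper G v)
                      (restrictCover C v)

  ψ : HMap (deleteVertex G v)
  ψ = proj₁ colouring

  ψ′ : HMap G
  ψ′ = insertAt ψ v false

  away-punchIn : ∀ x → degreeAway C ψ′ v (punchIn v x) ≤ bound i j (ψ′ (punchIn v x))
  away-punchIn x rewrite insertAt-punchIn ψ v false x = begin
    Σfin (erase v (links C (punchIn v x , ψ x) ψ′))    ≡⟨ Σfin-erase-punchIn v _ ⟩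
    Σfin (links C (punchIn v x , ψ x) ψ′ ∘ punchIn v)  ≡⟨ Σfin-cong links-punchIn ⟩
    degφ (restrictCover C v) ψ x                       ≤⟨ proj₂ colouring x ⟩
    bound i j (ψ x)                                    ∎
    where
    open ≤-Reasoning
    links-punchIn : ∀ x′ → links C (punchIn v x , ψ x) ψ′ (punchIn v x′) ≡
                           indicator (adj C (punchIn v x , ψ x) (punchIn v x′ , ψ x′))
    links-punchIn x′ = cong (λ b → indicator (adj C _ (punchIn v x′ , b))) (insertAt-punchIn ψ v false x′)

  away : ColouringAway i j C v ψ′
  away y y≢v = subst (λ z → degreeAway C ψ′ v z ≤ bound i j (ψ′ z))
                     (punchIn-punchOut (y≢v ∘ sym)) (away-punchIn _)

hits : ∀ {G} → Cover G → Fin (n G) → HMap G → Bool → Fin (n G) → Bool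
hits C v ψ φv u = adj C (v , φv) (u , ψ u)

module _ {i j : ℕ} {G : Multigraph} (C : Cover G) (v : Fin (n G)) (ψ : HMap G) (φv : Bool) where

  -- Every neighbour of degree ≥ 3 is a simple one that φv avoids.
  record GoodCentre : Set where
    field
      light : ∀ u → 1 ≤ mult G v u → (mult G v u ≡ 1 → hits C v ψ φv u ≡ true) → deg G u ≤ 2
      simpleHit⇒1≤i : ∀ u → mult G v u ≡ 1 → hits C v ψ φv u ≡ true → 1 ≤ i
      centre-degree : ∀ φ → (∀ u → mult G v u ≡ 1 → hits C v ψ φv u ≡ false → φ u ≡ ψ u) →
                      Σfin (erase v (links C (v , φv) φ)) ≤ bound i j φv

module _ {i j : ℕ} (i<j : i < j) {G : Multigraph} (C : Cover G) (v : Fin (n G)) (ψ : HMap G)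
         (few : nbrs G v ≤ suc i) where

  links≤neighbourTerm : ∀ φv φ u → erase v (links C (v , φv) φ) u ≤ neighbourTerm G v u
  links≤neighbourTerm φv φ u = erase-≤ v u λ u≢v → indicator-adj≤neighbourTerm C {b = φ u} (u≢v ∘ sym)

  links≤nbrs : ∀ φv φ → Σfin (erase v (links C (v , φv) φ)) ≤ nbrs G v
  links≤nbrs φv φ = Σfin-mono-≤ (links≤neighbourTerm φv φ)

  richCentre : (∀ u → mult G v u ≢ 1) → (∀ u → 1 ≤ mult G v u → deg G u ≤ 2) →
               GoodCentre {i} {j} C v ψ true
  richCentre noSimple allLight = record
    { light         = λ u edge _ → allLight u edge
    ; simpleHit⇒1≤i = λ u simple _ → contradiction simple (noSimple u)
    ; centre-degree = λ φ _ → ≤-trans (links≤nbrs true φ) (≤-trans few i<j)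
    }

  avoidingCentre : ∀ w → mult G v w ≡ 1 → (∀ u → u ≢ w → 1 ≤ mult G v u → deg G u ≤ 2) →
                   ∀ φv → hits C v ψ φv w ≡ false → GoodCentre {i} {j} C v ψ φv
  avoidingCentre w simpleʷ othersLight φv avoids = record
    { light         = λ u edge simple⇒hit → othersLight u (hit⇒≢w u simple⇒hit) edge
    ; simpleHit⇒1≤i = λ u simple hit →
                        ≤-pred (≤-trans (twoNeighbours u simple (hit⇒≢w u (λ _ → hit))) few)
    ; centre-degree = centre-degree
    }
    where
    open ≤-Reasoning

    hit⇒≢w : ∀ u → (mult G v u ≡ 1 → hits C v ψ φv u ≡ true) → u ≢ w
    hit⇒≢w u simple⇒hit refl = contradiction (trans (sym avoids) (simple⇒hit simpleʷ)) λ ()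

    twoNeighbours : ∀ u → mult G v u ≡ 1 → u ≢ w → 2 ≤ nbrs G v
    twoNeighbours u simple u≢w = begin
      2                                          ≡⟨ cong₂ _+_ (neighbourTerm-edge G (≤-reflexive (sym simple)))
                                                              (neighbourTerm-edge G (≤-reflexive (sym simpleʷ))) ⟨
      neighbourTerm G v u + neighbourTerm G v w  ≤⟨ fᵢ+fⱼ≤Σfin (neighbourTerm G v) u≢w ⟩
      nbrs G v                                   ∎

    w≢v : w ≢ v
    w≢v = edge⇒≢ G (≤-reflexive (sym simpleʷ)) ∘ sym

    centre-degree : ∀ φ → (∀ u → mult G v u ≡ 1 → hits C v ψ φv u ≡ false → φ u ≡ ψ u) →
                    Σfin (erase v (links C (v , φv) φ)) ≤ bound i j φv
    centre-degree φ keeps = begin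
      Σfin (erase v L)                          ≡⟨ Σfin-erase w (erase v L) ⟩
      erase v L w + Σfin (erase w (erase v L))  ≡⟨ cong (_+ Σfin (erase w (erase v L))) avoided ⟩
      Σfin (erase w (erase v L))                ≤⟨ Σfin-mono-≤ (λ u → erase-mono-≤ w u λ _ →
                                                     links≤neighbourTerm φv φ u) ⟩
      Σfin (erase w (neighbourTerm G v))        ≤⟨ ≤-pred (≤-trans (≤-reflexive (sym nbrs-split)) few) ⟩
      i                                         ≤⟨ i≤bound i<j φv ⟩
      bound i j φv                              ∎
      where
      L = links C (v , φv) φ

      avoided : erase v L w ≡ 0
      avoided = trans (erase-other L w≢v) (cong indicator
        (trans (cong (λ b → adj C (v , φv) (w , b)) (keeps w simpleʷ avoids)) avoids))

      nbrs-split : nbrs G v ≡ suc (Σfin (erase w (neighbourTerm G v)))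
      nbrs-split = trans (Σfin-erase w (neighbourTerm G v)) (cong (_+ Σfin (erase w (neighbourTerm G v)))
                                                                  (neighbourTerm-edge G (≤-reflexive (sym simpleʷ))))

  avoidingColour : ∀ w → mult G v w ≡ 1 → hits C v ψ (adj C (v , false) (w , ψ w)) w ≡ false
  avoidingColour w simple with adj C (v , false) (w , ψ w) in adjacent
  ... | false = adjacent
  ... | true  = simpleEdge-uniqueˡ C (edge⇒≢ G (≤-reflexive (sym simple))) simple adjacent

  goodCentre : edgesToDeg≥3 G v ≤ 1 → ∃[ φv ] GoodCentre {i} {j} C v ψ φv
  goodCentre sparse with shape G v sparse
  ... | noSimpleEdge noSimple allLight = true , richCentre noSimple allLight
  ... | simpleEdgeTo w simple othersLight =
    _ , avoidingCentre w simple othersLight _ (avoidingColour w simple)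

module Recolouring {i j : ℕ} (i<j : i < j) {G : Multigraph} (C : Cover G) (v : Fin (n G))
  (ψ : HMap G) (ψ-away : ColouringAway i j C v ψ)
  (φv : Bool) (centre : GoodCentre {i} {j} C v ψ φv) where

  open GoodCentre centre
  open ≤-Reasoning

  hit : Fin (n G) → Bool
  hit = hits C v ψ φv

  data Role (y : Fin (n G)) : Set where
    central : y ≡ v → Role y
    double  : y ≢ v → mult G v y ≡ 2 → Role y
    flipped : y ≢ v → mult G v y ≡ 1 → hit y ≡ true → 1 ≤ degreeAway C ψ v y → Role y
    kept    : y ≢ v → mult G v y ≢ 2 →
              ¬ (mult G v y ≡ 1 × hit y ≡ true × 1 ≤ degreeAway C ψ v y) → Role y

  role : ∀ y → Role y
  role y with y ≟ᶠ v
  ... | yes y≡v = central y≡v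
  ... | no y≢v with mult G v y ≟ 2
  ...   | yes doubleEdge = double y≢v doubleEdge
  ...   | no ¬double with (mult G v y ≟ 1) ×-dec ((hit y ≟ᵇ true) ×-dec (1 ≤? degreeAway C ψ v y))
  ...     | yes (simple , h , pos) = flipped y≢v simple h pos
  ...     | no ¬flip = kept y≢v ¬double ¬flip

  colourOf : ∀ y → Role y → Bool
  colourOf y (central _)       = φv
  colourOf y (double _ _)      = true
  colourOf y (flipped _ _ _ _) = not (ψ y)
  colourOf y (kept _ _ _)      = ψ y

  φ : HMap G
  φ y = colourOf y (role y)

  φ-central : φ v ≡ φv
  φ-central = colourOf-v (role v)
    where
    colourOf-v : (r : Role v) → colourOf v r ≡ φv
    colourOf-v (central _)         = refl
    colourOf-v (double v≢v _)      = contradiction refl v≢v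
    colourOf-v (flipped v≢v _ _ _) = contradiction refl v≢v
    colourOf-v (kept v≢v _ _)      = contradiction refl v≢v

  φ-keeps : ∀ u → mult G v u ≡ 1 → hit u ≡ false → φ u ≡ ψ u
  φ-keeps u simple miss = colourOf-u (role u)
    where
    colourOf-u : (r : Role u) → colourOf u r ≡ ψ u
    colourOf-u (central refl)     = contradiction refl (edge⇒≢ G (≤-reflexive (sym simple)))
    colourOf-u (double _ two)     = contradiction (trans (sym two) simple) λ ()
    colourOf-u (flipped _ _ h _)  = contradiction (trans (sym h) miss) λ ()
    colourOf-u (kept _ _ _)       = refl

  double-light : ∀ {y} → mult G v y ≡ 2 → deg G y ≤ 2
  double-light two = light _ (≤-trans (s≤s z≤n) (≤-reflexive (sym two)))
                             λ simple → contradiction (trans (sym two) simple) λ ()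

  -- Recolouring a vertex u ≠ v never creates an edge at a ψ-coloured vertex y ≠ v:
  -- a double neighbour of v has no other neighbours, and a flipped u has a single
  -- edge besides uv, which its ψ-colour already used.
  recolouring-harmless : ∀ {y u} → y ≢ v → u ≢ y → u ≢ v → (r : Role u) →
                         indicator (adj C (y , ψ y) (u , colourOf u r)) ≤ links C (y , ψ y) ψ u
  recolouring-harmless y≢v u≢y u≢v (central u≡v) = contradiction u≡v u≢v
  recolouring-harmless y≢v u≢y u≢v (kept _ _ _)   = ≤-refl
  recolouring-harmless {y} {u} y≢v u≢y u≢v (double _ two) =
    indicator-false≤ _ (noEdge⇒¬adj C (u≢y ∘ sym) (trans (msym G y u) isolated))
    where
    isolated : mult G u y ≡ 0
    isolated = light-double⇒isolated G (double-light two) (trans (msym G u v) two) y≢v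
  recolouring-harmless {y} {u} y≢v u≢y u≢v (flipped _ simple h pos)
    with Σfin-positive (erase v (links C (u , ψ u) ψ)) pos
  ... | z , linkᶻ with erase-positive v (links C (u , ψ u) ψ) linkᶻ
  ...   | z≢v , adjᶻ = harmless (y ≟ᶠ z)
    where
    adjacent : adj C (u , ψ u) (z , ψ z) ≡ true
    adjacent = indicator-positive adjᶻ

    rest≤1 : Σfin (erase v (mult G u)) ≤ 1
    rest≤1 = degreeWithout≤ G (light u (≤-reflexive (sym simple)) (λ _ → h)) (trans (msym G u v) simple)

    edgeᶻ : 1 ≤ erase v (mult G u) z
    edgeᶻ = ≤-trans (adj⇒edge C (adj⇒≢ C ψ adjacent) adjacent)
                    (≤-reflexive (sym (erase-other (mult G u) z≢v)))

    harmless : Dec (y ≡ z) → indicator (adj C (y , ψ y) (u , not (ψ u))) ≤ links C (y , ψ y) ψ u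
    harmless (yes refl) =
      indicator-false≤ _ (simpleEdge-unique C (u≢y ∘ sym) simpleᵘʸ (trans (adjSym C _ _) adjacent))
      where
      simpleᵘʸ : mult G y u ≡ 1
      simpleᵘʸ = trans (msym G y u) (≤-antisym
        (≤-trans (≤-reflexive (sym (erase-other (mult G u) y≢v))) (≤-trans (fᵢ≤Σfin y _) rest≤1))
        (≤-trans edgeᶻ (≤-reflexive (erase-other (mult G u) y≢v))))
    harmless (no y≢z) = indicator-false≤ _ (noEdge⇒¬adj C (u≢y ∘ sym) (trans (msym G y u) (begin-equality
      mult G u y              ≡⟨ erase-other (mult G u) y≢v ⟨
      erase v (mult G u) y    ≡⟨ Σfin≤1⇒other≡0 (erase v (mult G u)) rest≤1 (y≢z ∘ sym) edgeᶻ ⟩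
      0                       ∎)))

  splitAtCentre : ∀ {y} (L : Fin (n G) → ℕ) → y ≢ v →
                  Σfin (erase y L) ≡ L v + Σfin (erase v (erase y L))
  splitAtCentre {y} L y≢v = trans (Σfin-erase v (erase y L))
                                  (cong (_+ Σfin (erase v (erase y L))) (erase-other L (y≢v ∘ sym)))

  awayFromCentre≤ : ∀ {y} a → Σfin (erase v (erase y (links C (y , a) φ))) ≤ Σfin (erase v (mult G y))
  awayFromCentre≤ {y} a = Σfin-mono-≤ λ u → erase-mono-≤ v u λ _ → erase-≤ y u λ u≢y →
                            indicator-adj≤mult C (u≢y ∘ sym)

  1≤j : 1 ≤ j
  1≤j = ≤-trans (s≤s z≤n) i<j

  rowBound : ∀ y (r : Role y) → Σfin (erase y (links C (y , colourOf y r) φ)) ≤ bound i j (colourOf y r)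
  rowBound y (central refl) = centre-degree φ φ-keeps
  rowBound y (double y≢v two) = begin
    Σfin (erase y L)                             ≡⟨ splitAtCentre L y≢v ⟩
    L v + Σfin (erase v (erase y L))             ≤⟨ +-mono-≤ (indicator≤1 _) (awayFromCentre≤ true) ⟩
    1 + Σfin (erase v (mult G y))                ≤⟨ +-monoʳ-≤ 1 (degreeWithout≤ G (double-light two)
                                                                               (trans (msym G y v) two)) ⟩
    1                                            ≤⟨ 1≤j ⟩
    j                                            ∎
    where L = links C (y , true) φ
  rowBound y (flipped y≢v simple h _) = begin
    Σfin (erase y L)                             ≡⟨ splitAtCentre L y≢v ⟩
    L v + Σfin (erase v (erase y L))             ≡⟨ cong (_+ Σfin (erase v (erase y L))) unlinked ⟩
    Σfin (erase v (erase y L))                   ≤⟨ awayFromCentre≤ (not (ψ y)) ⟩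
    Σfin (erase v (mult G y))                    ≤⟨ degreeWithout≤ G (light y (≤-reflexive (sym simple)) (λ _ → h))
                                                                     (trans (msym G y v) simple) ⟩
    1                                            ≤⟨ ≤-trans (simpleHit⇒1≤i y simple h) (i≤bound i<j _) ⟩
    bound i j (not (ψ y))                        ∎
    where
    L = links C (y , not (ψ y)) φ
    unlinked : L v ≡ 0
    unlinked = cong indicator (trans (cong (λ b → adj C (y , not (ψ y)) (v , b)) φ-central)
                                     (trans (adjSym C _ _) (simpleEdge-unique C (y≢v ∘ sym) simple h)))
  rowBound y (kept y≢v ¬double ¬flip) = begin
    Σfin (erase y L)                             ≡⟨ splitAtCentre L y≢v ⟩
    L v + Σfin (erase v (erase y L))             ≡⟨ cong (_+ Σfin (erase v (erase y L))) linkToCentre ⟩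
    indicator (hit y) + Σfin (erase v (erase y L)) ≤⟨ +-monoʳ-≤ (indicator (hit y)) (Σfin-mono-≤ λ u →
                                                     erase-mono-≤ v u λ u≢v → erase-≤ y u λ u≢y →
                                                       recolouring-harmless y≢v u≢y u≢v (role u)) ⟩
    indicator (hit y) + degreeAway C ψ v y       ≤⟨ keptBound (hit y) refl ⟩
    bound i j (ψ y)                              ∎
    where
    L = links C (y , ψ y) φ
    linkToCentre : L v ≡ indicator (hit y)
    linkToCentre = cong indicator (trans (cong (λ b → adj C (y , ψ y) (v , b)) φ-central) (adjSym C _ _))

    keptBound : ∀ b → hit y ≡ b → indicator b + degreeAway C ψ v y ≤ bound i j (ψ y)
    keptBound false _ = ψ-away y y≢v
    keptBound true h = begin
      1 + degreeAway C ψ v y   ≡⟨ cong (1 +_) (n<1⇒n≡0 (≰⇒> λ pos → ¬flip (simple , h , pos))) ⟩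
      1                        ≤⟨ ≤-trans (simpleHit⇒1≤i y simple h) (i≤bound i<j _) ⟩
      bound i j (ψ y)          ∎
      where
      edge : 1 ≤ mult G v y
      edge = adj⇒edge C (y≢v ∘ sym) h
      simple : mult G v y ≡ 1
      simple = ≤-antisym (≤-pred (≤∧≢⇒< (begin
        mult G v y   ≡⟨ msym G v y ⟩
        mult G y v   ≤⟨ mult≤deg G y v ⟩
        deg G y      ≤⟨ light y edge (λ _ → h) ⟩
        2            ∎) ¬double)) edge

  isColouring : IsColoring i j C φ
  isColouring y = ≤-trans (≤-reflexive (degφ-erase C φ y)) (rowBound y (role y))

fewNeighbours⇒colourable : ∀ {i j} → i < j → ∀ G → Critical i j G → ∀ v →
                           edgesToDeg≥3 G v ≤ 1 → nbrs G v ≤ suc i → (C : Cover G) → Colorable i j C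
fewNeighbours⇒colourable i<j G critical v sparse few C
  with colouringAway G critical C v
... | ψ , ψ-away with goodCentre i<j C v ψ few sparse
...   | φv , centre = φ , isColouring
  where open Recolouring i<j C v ψ ψ-away φv centre

lemma10p4 : (i j : ℕ) → i < j → (G : Multigraph) → Critical i j G →
    (v : Fin (n G)) → edgesToDeg≥3 G v ≤ 1 → i + 2 ≤ nbrs G v
lemma10p4 i j i<j G critical@((C , uncolourable) , _) v sparse with i + 2 ≤? nbrs G v
... | yes enough = enough
... | no notEnough = contradiction (fewNeighbours⇒colourable i<j G critical v sparse few C) uncolourable
  where
  few : nbrs G v ≤ suc i
  few = ≤-pred (≤-trans (≰⇒> notEnough) (≤-reflexive (+-comm i 2)))
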